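{- Let $n\ge 6$. Then $w_2=\lfloor (3n-2)/2\rfloor$, and, with $\mathbf{b}_1=\overline{10}[n]$, $\mathbf{b}_2=01\cdot\overline{0}[n-2]$, $\mathbf{b}_3=\overline{0}[n-2]\cdot 11$, $\mathbf{b}_4=\overline{01}[n]$, $\mathbf{b}_5=11\cdot\overline{0}[n-2]$, $\mathbf{b}_6=\overline{0}[n-2]\cdot 10$: (i) if $n=6$, then $W_2=\{\mathbf{b}_1,\ldots,\mathbf{b}_6,001000,000100,001100\}$; (ii) if $n=7$, then $W_2=\{\mathbf{b}_2,\mathbf{b}_4,\mathbf{b}_6,0001000\}$; (iii) if $n\ge 8$ is even, then $W_2=\{\mathbf{b}_1,\mathbf{b}_2,\mathbf{b}_3,\mathbf{b}_4,\mathbf{b}_5,\mathbf{b}_6\}$; (iv) if $n\ge 9$ is odd, then $W_2=\{\mathbf{b}_2,\mathbf{b}_4,\mathbf{b}_6\}$.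
   Context: For $\mathbf{x}=(x_0,\ldots,x_{n-1})\in\mathbb{F}_2^n$, the derivative is $\partial\mathbf{x}=(x_0+x_1,\ldots,x_{n-2}+x_{n-1})\in\mathbb{F}_2^{n-1}$, with $\partial^0\mathbf{x}=\mathbf{x}$ and $\partial^i\mathbf{x}=\partial(\partial^{i-1}\mathbf{x})$. The Steinhaus triangle is $T(\mathbf{x})=(\mathbf{x},\partial\mathbf{x},\ldots,\partial^{n-1}\mathbf{x})$; $|\mathbf{y}|$ is the number of ones of a binary sequence and $|T(\mathbf{x})|=\sum_{i=0}^{n-1}|\partial^i\mathbf{x}|$. For fixed $n$, let $0=w_0<w_1<\cdots<w_m$ be the distinct values of $|T(\mathbf{x})|$ over $\mathbf{x}\in\mathbb{F}_2^n$, and $W_i=\{\mathbf{x}\in\mathbb{F}_2^n:|T(\mathbf{x})|=w_i\}$. Sequences are written as words; a dot denotes concatenation; $\overline{x_1\cdots x_p}[k]$ is the word of the first $k$ letters of the infinite periodic word $x_1\cdots x_px_1\cdots x_p\cdots$. -}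

module Defs where

open import Data.Bool using (Bool; true; false; _xor_)
open import Data.Nat using (ℕ; zero; suc; _+_; _<_)
open import Data.Vec using (Vec; []; _∷_; replicate; _∷ʳ_)
open import Data.Product using (Σ; ∃; _×_)
open import Relation.Binary.PropositionalEquality using (_≡_)
open import Relation.Nullary using (¬_)

-- Binary sequences of length n over F_2 are vectors of Bool (true = 1, addition = xor).

∂ : ∀ {n} → Vec Bool (suc n) → Vec Bool n
∂ (x ∷ []) = []
∂ (x ∷ y ∷ xs) = (x xor y) ∷ ∂ (y ∷ xs)

weight : ∀ {n} → Vec Bool n → ℕ
weight [] = 0
weight (true ∷ xs) = suc (weight xs)
weight (false ∷ xs) = weight xs

triWeight : ∀ {n} → Vec Bool n → ℕ
triWeight {zero} x = 0
triWeight {suc n} x = weight x + triWeight (∂ x)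

Achieved : ℕ → ℕ → Set
Achieved n v = Σ (Vec Bool n) (λ x → triWeight x ≡ v)

-- IsNth P i v : v is the i-th smallest (0-indexed) element of the set P ⊆ ℕ,
-- i.e. v = w_i when P is the set of distinct values w_0 < w_1 < ...
IsNth : (ℕ → Set) → ℕ → ℕ → Set
IsNth P zero v = P v × (∀ k → k < v → ¬ P k)
IsNth P (suc i) v = P v × ∃ (λ u → u < v × IsNth P i u × (∀ k → u < k → k < v → ¬ P k))

alt : Bool → Bool → (k : ℕ) → Vec Bool k
alt a b zero = []
alt a b (suc k) = a ∷ alt b a k

b1 b2 b3 b4 b5 b6 : (m : ℕ) → Vec Bool (suc (suc m))
b1 m = alt true false (suc (suc m))
b2 m = false ∷ true ∷ replicate m false
b3 m = replicate m false ∷ʳ true ∷ʳ true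
b4 m = alt false true (suc (suc m))
b5 m = true ∷ true ∷ replicate m false
b6 m = replicate m false ∷ʳ true ∷ʳ false

-- A word x is recovered from its first letter and its derivative, and |T x| = |x| + |T ∂x|.
-- Say that length n is classified if every word either is one of 0…0, 10…0, 0…01, 1…1
-- (where |T x| is 0 or n), or lies in W₂ (where |T x| = w₂), or has |T x| > w₂. Integrating
-- the classification of length n − 1 gives that of length n: w₂ grows by 1 from even to odd
-- length and by 2 from odd to even, so only integrals of weight at most 2 can hit w₂ and those
-- are found by inspecting b1 … b6. For words of weight one at even length the classification
-- of length n − 2 is needed as well. Lengths 6, 7 and 8 are checked by exhaustive computation.

module Submission where

open import Defs
open import Data.Bool using (Bool; true; false; _xor_; not)
import Data.Bool as Bool
open import Data.Empty using (⊥-elim)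
open import Data.List using (List; []; _∷_; map; _++_)
open import Data.List.Membership.Propositional using (_∈_)
open import Data.List.Membership.Propositional.Properties using (∈-map⁺; ∈-++⁺ˡ; ∈-++⁺ʳ)
import Data.List.Membership.DecPropositional as DecMembership
open import Data.List.Relation.Unary.All as All using (all?)
open import Data.List.Relation.Unary.Any using (here; there)
open import Data.Nat using (ℕ; zero; suc; _+_; _*_; _∸_; _≤_; _<_; z≤n; s≤s; _/_; _%_; _<?_; _≟_)
open import Data.Nat.DivMod using (+-distrib-/-∣ˡ; [m+kn]%n≡m%n)
open import Data.Nat.Divisibility using (divides-refl)
open import Data.Nat.Properties
open import Data.Nat.Tactic.RingSolver using (solve-∀)
open import Data.Product using (_×_; _,_; ∃-syntax)
open import Data.Sum using (_⊎_; inj₁; inj₂)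
open import Data.Vec using (Vec; []; _∷_; replicate; _∷ʳ_; head)
open import Data.Vec.Properties using (≡-dec)
open import Function using (_∘_)
open import Function.Bundles using (_⇔_; mk⇔)
open import Relation.Binary.Definitions using (DecidableEquality)
open import Relation.Binary.PropositionalEquality
open import Relation.Nullary using (yes; no; ¬_)
open import Relation.Nullary.Decidable using (True; toWitness)
open import Relation.Unary using (Decidable)

zeros ones : ∀ n → Vec Bool n
zeros n = replicate n false
ones n = replicate n true

unitFirst unitLast : ∀ n → Vec Bool (suc n)
unitFirst n = true ∷ zeros n
unitLast n = zeros n ∷ʳ true

-- Split through integrateTail so that integrate a d is a cons without inspecting d.
integrate : ∀ {n} → Bool → Vec Bool n → Vec Bool (suc n)
integrateTail : ∀ {n} → Bool → Vec Bool n → Vec Bool n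
integrate a d = a ∷ integrateTail a d
integrateTail a [] = []
integrateTail a (d ∷ ds) = integrate (a xor d) ds

∂-integrate : ∀ {n} a (d : Vec Bool n) → ∂ (integrate a d) ≡ d
∂-integrate a [] = refl
∂-integrate false (d ∷ ds) = cong (d ∷_) (∂-integrate d ds)
∂-integrate true (false ∷ ds) = cong (false ∷_) (∂-integrate true ds)
∂-integrate true (true ∷ ds) = cong (true ∷_) (∂-integrate false ds)

integrate-∂ : ∀ {n} (x : Vec Bool (suc n)) → integrate (head x) (∂ x) ≡ x
integrate-∂ (a ∷ []) = refl
integrate-∂ (false ∷ b ∷ xs) = cong (false ∷_) (integrate-∂ (b ∷ xs))
integrate-∂ (true ∷ false ∷ xs) = cong (true ∷_) (integrate-∂ (false ∷ xs))
integrate-∂ (true ∷ true ∷ xs) = cong (true ∷_) (integrate-∂ (true ∷ xs))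

integrate-elim : ∀ {n} (P : Vec Bool (suc n) → Set) → (∀ a d → P (integrate a d)) → ∀ x → P x
integrate-elim P p x = subst P (integrate-∂ x) (p (head x) (∂ x))

triWeight-integrate : ∀ {n} a (d : Vec Bool n) →
                      triWeight (integrate a d) ≡ weight (integrate a d) + triWeight d
triWeight-integrate a d = cong (weight (integrate a d) +_) (cong triWeight (∂-integrate a d))

triWeight-integrate-≥ : ∀ {n} a (d : Vec Bool n) {j t} →
                        j ≤ weight (integrate a d) → t ≤ triWeight d → j + t ≤ triWeight (integrate a d)
triWeight-integrate-≥ a d {j} {t} j≤ t≤ = subst (j + t ≤_) (sym (triWeight-integrate a d)) (+-mono-≤ j≤ t≤)

weight-zeros : ∀ n → weight (zeros n) ≡ 0
weight-zeros zero = refl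
weight-zeros (suc n) = weight-zeros n

weight-ones : ∀ n → weight (ones n) ≡ n
weight-ones zero = refl
weight-ones (suc n) = cong suc (weight-ones n)

weight-∷ʳ : ∀ {n} (v : Vec Bool n) b → weight (v ∷ʳ b) ≡ weight v + weight (b ∷ [])
weight-∷ʳ [] b = refl
weight-∷ʳ (true ∷ v) b = cong suc (weight-∷ʳ v b)
weight-∷ʳ (false ∷ v) b = weight-∷ʳ v b

weight≡0⇒zeros : ∀ {n} (v : Vec Bool n) → weight v ≡ 0 → v ≡ zeros n
weight≡0⇒zeros [] _ = refl
weight≡0⇒zeros (false ∷ v) eq = cong (false ∷_) (weight≡0⇒zeros v eq)

∂-replicate : ∀ a n → ∂ (replicate (suc n) a) ≡ zeros n
∂-replicate a zero = refl
∂-replicate false (suc n) = cong (false ∷_) (∂-replicate false n)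
∂-replicate true (suc n) = cong (false ∷_) (∂-replicate true n)

triWeight-zeros : ∀ n → triWeight (zeros n) ≡ 0
triWeight-zeros zero = refl
triWeight-zeros (suc n) = begin
  weight (zeros (suc n)) + triWeight (∂ (zeros (suc n)))
    ≡⟨ cong₂ _+_ (weight-zeros (suc n)) (cong triWeight (∂-replicate false n)) ⟩
  triWeight (zeros n)
    ≡⟨ triWeight-zeros n ⟩
  0 ∎
  where open ≡-Reasoning

triWeight-ones : ∀ n → triWeight (ones n) ≡ n
triWeight-ones zero = refl
triWeight-ones (suc n) = trans (cong₂ _+_ (weight-ones (suc n))
  (trans (cong triWeight (∂-replicate true n)) (triWeight-zeros n))) (+-identityʳ (suc n))

∂-unitFirst : ∀ n → ∂ (unitFirst (suc n)) ≡ unitFirst n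
∂-unitFirst n = cong (true ∷_) (∂-replicate false n)

∂-unitLast : ∀ n → ∂ (unitLast (suc n)) ≡ unitLast n
∂-unitLast zero = refl
∂-unitLast (suc n) = cong (false ∷_) (∂-unitLast n)

weight-unitLast : ∀ n → weight (unitLast n) ≡ 1
weight-unitLast n = trans (weight-∷ʳ (zeros n) true) (cong (_+ 1) (weight-zeros n))

triWeight-unitFirst : ∀ n → triWeight (unitFirst n) ≡ suc n
triWeight-unitFirst zero = refl
triWeight-unitFirst (suc n) = cong₂ _+_ (cong suc (weight-zeros (suc n)))
  (trans (cong triWeight (∂-unitFirst n)) (triWeight-unitFirst n))

triWeight-unitLast : ∀ n → triWeight (unitLast n) ≡ suc n
triWeight-unitLast zero = refl
triWeight-unitLast (suc n) = cong₂ _+_ (weight-unitLast (suc n))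
  (trans (cong triWeight (∂-unitLast n)) (triWeight-unitLast n))

weight-∂-≤ : ∀ {n} (v : Vec Bool (suc n)) → weight (∂ v) ≤ weight v + weight v
weight-∂-≤ v = ≤-trans (m≤n+m _ _) (head-counted-once v)
  where
  head-counted-once : ∀ {n} (v : Vec Bool (suc n)) → weight (head v ∷ []) + weight (∂ v) ≤ weight v + weight v
  head-counted-once (true ∷ []) = s≤s z≤n
  head-counted-once (false ∷ []) = z≤n
  head-counted-once (false ∷ false ∷ w) = head-counted-once (false ∷ w)
  head-counted-once (false ∷ true ∷ w) = head-counted-once (true ∷ w)
  head-counted-once (true ∷ false ∷ w) =
    s≤s (subst (suc (weight (∂ (false ∷ w))) ≤_) (sym (+-suc (weight w) (weight w)))
               (s≤s (head-counted-once (false ∷ w))))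
  head-counted-once (true ∷ true ∷ w) =
    ≤-trans (head-counted-once (true ∷ w)) (+-mono-≤ (n≤1+n (suc (weight w))) (n≤1+n (suc (weight w))))

weight-∂≡1⇒unit : ∀ {n} (v : Vec Bool (suc n)) → weight v ≡ 1 → weight (∂ v) ≡ 1 →
                  v ≡ unitFirst n ⊎ v ≡ unitLast n
weight-∂≡1⇒unit (a ∷ []) _ ()
weight-∂≡1⇒unit (true ∷ w) eq _ = inj₁ (cong (true ∷_) (weight≡0⇒zeros w (suc-injective eq)))
weight-∂≡1⇒unit (false ∷ true ∷ []) _ _ = inj₂ refl
weight-∂≡1⇒unit (false ∷ true ∷ true ∷ w) () _
weight-∂≡1⇒unit (false ∷ true ∷ false ∷ w) _ ()
weight-∂≡1⇒unit (false ∷ false ∷ w) eq eq′ with weight-∂≡1⇒unit (false ∷ w) eq eq′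
... | inj₂ p = inj₂ (cong (false ∷_) p)

weight-integrate≡0 : ∀ {n} a (d : Vec Bool n) → weight (integrate a d) ≡ 0 → triWeight d ≡ 0
weight-integrate≡0 {n} a d eq = begin
  triWeight d                          ≡⟨ cong triWeight (∂-integrate a d) ⟨
  triWeight (∂ (integrate a d))        ≡⟨ cong (triWeight ∘ ∂) (weight≡0⇒zeros (integrate a d) eq) ⟩
  triWeight (∂ (zeros (suc n)))        ≡⟨ cong triWeight (∂-replicate false n) ⟩
  triWeight (zeros n)                  ≡⟨ triWeight-zeros n ⟩
  0                                    ∎
  where open ≡-Reasoning

weight-integrate≡1⇒weight≤2 : ∀ {n} a (d : Vec Bool n) → weight (integrate a d) ≡ 1 → weight d ≤ 2
weight-integrate≡1⇒weight≤2 a d eq = subst (λ v → weight v ≤ 2) (∂-integrate a d)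
  (subst (λ w → weight (∂ (integrate a d)) ≤ w + w) eq (weight-∂-≤ (integrate a d)))

≡zeros⇒weight≢1 : ∀ {n} {x : Vec Bool n} → x ≡ zeros n → weight x ≢ 1
≡zeros⇒weight≢1 {n} refl eq with trans (sym (weight-zeros n)) eq
... | ()

integrate-zeros : ∀ a n → integrate a (zeros n) ≡ replicate (suc n) a
integrate-zeros a zero = refl
integrate-zeros false (suc n) = cong (false ∷_) (integrate-zeros false n)
integrate-zeros true (suc n) = cong (true ∷_) (integrate-zeros true n)

integrate-ones : ∀ a n → integrate a (ones n) ≡ alt a (not a) (suc n)
integrate-ones a zero = refl
integrate-ones false (suc n) = cong (false ∷_) (integrate-ones true n)
integrate-ones true (suc n) = cong (true ∷_) (integrate-ones false n)

integrate-zeros-∷ʳ : ∀ a n u → integrate a (zeros n ∷ʳ u) ≡ replicate (suc n) a ∷ʳ (a xor u)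
integrate-zeros-∷ʳ a zero u = refl
integrate-zeros-∷ʳ false (suc n) u = cong (false ∷_) (integrate-zeros-∷ʳ false n u)
integrate-zeros-∷ʳ true (suc n) u = cong (true ∷_) (integrate-zeros-∷ʳ true n u)

integrate-unitFirst : ∀ n → integrate true (unitFirst n) ≡ unitFirst (suc n)
integrate-unitFirst n = cong (true ∷_) (integrate-zeros false n)

integrate-unitLast : ∀ n → integrate false (unitLast n) ≡ unitLast (suc n)
integrate-unitLast n = integrate-zeros-∷ʳ false n true

triWeight-integrate-unitFirst : ∀ n → triWeight (integrate false (unitFirst n)) ≡ suc n + suc n
triWeight-integrate-unitFirst n = begin
  triWeight (integrate false (unitFirst n))
    ≡⟨ triWeight-integrate false (unitFirst n) ⟩
  weight (integrate true (zeros n)) + triWeight (unitFirst n)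
    ≡⟨ cong₂ _+_ (cong weight (integrate-zeros true n)) (triWeight-unitFirst n) ⟩
  weight (ones (suc n)) + suc n
    ≡⟨ cong (_+ suc n) (weight-ones (suc n)) ⟩
  suc n + suc n ∎
  where open ≡-Reasoning

triWeight-integrate-unitLast : ∀ n → triWeight (integrate true (unitLast n)) ≡ suc n + suc n
triWeight-integrate-unitLast n = begin
  triWeight (integrate true (unitLast n))
    ≡⟨ triWeight-integrate true (unitLast n) ⟩
  weight (integrate true (unitLast n)) + triWeight (unitLast n)
    ≡⟨ cong₂ _+_ (cong weight (integrate-zeros-∷ʳ true n true)) (triWeight-unitLast n) ⟩
  weight (ones (suc n) ∷ʳ false) + suc n
    ≡⟨ cong (_+ suc n) (weight-∷ʳ (ones (suc n)) false) ⟩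
  (weight (ones (suc n)) + 0) + suc n
    ≡⟨ cong (_+ suc n) (trans (+-identityʳ _) (weight-ones (suc n))) ⟩
  suc n + suc n ∎
  where open ≡-Reasoning

∂-alt : ∀ a n → ∂ (alt a (not a) (suc n)) ≡ ones n
∂-alt a zero = refl
∂-alt false (suc n) = cong (true ∷_) (∂-alt true n)
∂-alt true (suc n) = cong (true ∷_) (∂-alt false n)

triWeight-alt : ∀ a n → triWeight (alt a (not a) (suc n)) ≡ weight (alt a (not a) (suc n)) + n
triWeight-alt a n = cong (weight (alt a (not a) (suc n)) +_) (trans (cong triWeight (∂-alt a n)) (triWeight-ones n))

weight-alt-even : ∀ a k → weight (alt a (not a) (k * 2)) ≡ k
weight-alt-even a zero = refl
weight-alt-even false (suc k) = cong suc (weight-alt-even false k)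
weight-alt-even true (suc k) = cong suc (weight-alt-even true k)

-- w₂ for words of length 2 + m, indexed like b1 … b6.
secondWeight : ℕ → ℕ
secondWeight zero = 2
secondWeight (suc zero) = 3
secondWeight (suc (suc m)) = 3 + secondWeight m

secondWeight-even : ∀ k → secondWeight (k * 2) ≡ suc k + suc (k * 2)
secondWeight-even zero = refl
secondWeight-even (suc k) = trans (cong (3 +_) (secondWeight-even k)) (shift k)
  where
  shift : ∀ k → 3 + (suc k + suc (k * 2)) ≡ suc (suc k) + suc (suc k * 2)
  shift = solve-∀

secondWeight-suc-even : ∀ k → secondWeight (suc (k * 2)) ≡ suc (secondWeight (k * 2))
secondWeight-suc-even zero = refl
secondWeight-suc-even (suc k) = cong (3 +_) (secondWeight-suc-even k)

secondWeight-odd : ∀ k → secondWeight (suc (k * 2)) ≡ suc k + suc (suc (k * 2))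
secondWeight-odd k = begin
  secondWeight (suc (k * 2)) ≡⟨ secondWeight-suc-even k ⟩
  suc (secondWeight (k * 2)) ≡⟨ cong suc (secondWeight-even k) ⟩
  suc (suc k + suc (k * 2))  ≡⟨ +-suc (suc k) (suc (k * 2)) ⟨
  suc k + suc (suc (k * 2))  ∎
  where open ≡-Reasoning

0<secondWeight : ∀ m → 0 < secondWeight m
0<secondWeight zero = s≤s z≤n
0<secondWeight (suc zero) = s≤s z≤n
0<secondWeight (suc (suc m)) = s≤s z≤n

length≤secondWeight : ∀ m → 2 + m ≤ secondWeight m
length≤secondWeight zero = ≤-refl
length≤secondWeight (suc zero) = ≤-refl
length≤secondWeight (suc (suc m)) = ≤-trans (n≤1+n _) (s≤s (s≤s (s≤s (length≤secondWeight m))))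

length<secondWeight : ∀ m → 2 + (2 + m) < secondWeight (2 + m)
length<secondWeight m = s≤s (s≤s (s≤s (length≤secondWeight m)))

secondWeight<double : ∀ m → secondWeight (suc m) < (2 + m) + (2 + m)
secondWeight<double zero = ≤-refl
secondWeight<double (suc zero) = ≤-refl
secondWeight<double (suc (suc m)) =
  <-≤-trans (+-monoʳ-< 3 (secondWeight<double m)) (subst (3 + ((2 + m) + (2 + m)) ≤_) (grow m) (n≤1+n _))
  where
  grow : ∀ m → 4 + ((2 + m) + (2 + m)) ≡ (4 + m) + (4 + m)
  grow = solve-∀

secondWeight-formula : ∀ m → secondWeight m ≡ (3 * (2 + m) ∸ 2) / 2
secondWeight-formula zero = refl
secondWeight-formula (suc zero) = refl
secondWeight-formula (suc (suc m)) = begin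
  3 + secondWeight m                   ≡⟨ cong (3 +_) (secondWeight-formula m) ⟩
  3 + (3 * (2 + m) ∸ 2) / 2            ≡⟨ +-distrib-/-∣ˡ {6} (3 * (2 + m) ∸ 2) {2} (divides-refl 3) ⟨
  (6 + (3 * (2 + m) ∸ 2)) / 2          ≡⟨ cong (_/ 2) (six-more m) ⟩
  (3 * (4 + m) ∸ 2) / 2                ∎
  where
  open ≡-Reasoning
  six-more : ∀ m → 6 + (m + (2 + m + (2 + m + 0))) ≡ 2 + m + (4 + m + (4 + m + 0))
  six-more = solve-∀

∂-zeros-∷ʳ-∷ʳ : ∀ n u v → ∂ (zeros (suc n) ∷ʳ u ∷ʳ v) ≡ zeros n ∷ʳ u ∷ʳ (u xor v)
∂-zeros-∷ʳ-∷ʳ zero u v = refl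
∂-zeros-∷ʳ-∷ʳ (suc n) u v = cong (false ∷_) (∂-zeros-∷ʳ-∷ʳ n u v)

weight-zeros-∷ʳ-∷ʳ : ∀ n u v → weight (zeros n ∷ʳ u ∷ʳ v) ≡ weight (u ∷ v ∷ [])
weight-zeros-∷ʳ-∷ʳ zero u v = refl
weight-zeros-∷ʳ-∷ʳ (suc n) u v = weight-zeros-∷ʳ-∷ʳ n u v

triWeight-∂∂ : ∀ {n} (x : Vec Bool (suc (suc n))) {p q y} →
               weight x ≡ p → weight (∂ x) ≡ q → ∂ (∂ x) ≡ y → triWeight x ≡ p + q + triWeight y
triWeight-∂∂ x {p} {q} refl refl eq = trans (cong (λ t → weight x + (weight (∂ x) + t)) (cong triWeight eq))
  (sym (+-assoc p q _))

∂-b2 : ∀ m → ∂ (b2 (suc m)) ≡ b5 m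
∂-b2 m = cong (λ v → true ∷ true ∷ v) (∂-replicate false m)

∂-b5 : ∀ m → ∂ (b5 (suc m)) ≡ b2 m
∂-b5 m = cong (λ v → false ∷ true ∷ v) (∂-replicate false m)

∂-b6 : ∀ m → ∂ (b6 (suc m)) ≡ b3 m
∂-b6 m = ∂-zeros-∷ʳ-∷ʳ m true false

∂-b3 : ∀ m → ∂ (b3 (suc m)) ≡ b6 m
∂-b3 m = ∂-zeros-∷ʳ-∷ʳ m true true

weight-b2 : ∀ m → weight (b2 m) ≡ 1
weight-b2 m = cong suc (weight-zeros m)

weight-b5 : ∀ m → weight (b5 m) ≡ 2
weight-b5 m = cong (2 +_) (weight-zeros m)

weight-b6 : ∀ m → weight (b6 m) ≡ 1
weight-b6 m = weight-zeros-∷ʳ-∷ʳ m true false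

weight-b3 : ∀ m → weight (b3 m) ≡ 2
weight-b3 m = weight-zeros-∷ʳ-∷ʳ m true true

integrate-b2 : ∀ m → integrate true (b2 m) ≡ b5 (suc m)
integrate-b2 m = trans (cong (integrate true) (sym (∂-b5 m))) (integrate-∂ (b5 (suc m)))

integrate-b5 : ∀ m → integrate false (b5 m) ≡ b2 (suc m)
integrate-b5 m = trans (cong (integrate false) (sym (∂-b2 m))) (integrate-∂ (b2 (suc m)))

integrate-b3 : ∀ m → integrate false (b3 m) ≡ b6 (suc m)
integrate-b3 m = trans (cong (integrate false) (sym (∂-b6 m))) (integrate-∂ (b6 (suc m)))

integrate-b6 : ∀ m → integrate false (b6 m) ≡ b3 (suc m)
integrate-b6 m = trans (cong (integrate false) (sym (∂-b3 m))) (integrate-∂ (b3 (suc m)))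

≡b3⇒weight≢1 : ∀ {m} {x : Vec Bool (2 + m)} → x ≡ b3 m → weight x ≢ 1
≡b3⇒weight≢1 {m} refl eq with trans (sym (weight-b3 m)) eq
... | ()

triWeight-b2 : ∀ m → triWeight (b2 m) ≡ secondWeight m
triWeight-b2 zero = refl
triWeight-b2 (suc zero) = refl
triWeight-b2 (suc (suc m)) = trans
  (triWeight-∂∂ (b2 (2 + m)) (weight-b2 (2 + m)) (trans (cong weight (∂-b2 (suc m))) (weight-b5 (suc m)))
                (trans (cong ∂ (∂-b2 (suc m))) (∂-b5 m)))
  (cong (3 +_) (triWeight-b2 m))

triWeight-b5 : ∀ k → triWeight (b5 (k * 2)) ≡ secondWeight (k * 2)
triWeight-b5 zero = refl
triWeight-b5 (suc k) = trans
  (triWeight-∂∂ (b5 (2 + k * 2)) (weight-b5 (2 + k * 2)) (trans (cong weight (∂-b5 (suc (k * 2)))) (weight-b2 (suc (k * 2))))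
                (trans (cong ∂ (∂-b5 (suc (k * 2)))) (∂-b2 (k * 2))))
  (cong (3 +_) (triWeight-b5 k))

triWeight-b6 : ∀ m → triWeight (b6 m) ≡ secondWeight m
triWeight-b6 zero = refl
triWeight-b6 (suc zero) = refl
triWeight-b6 (suc (suc m)) = trans
  (triWeight-∂∂ (b6 (2 + m)) (weight-b6 (2 + m)) (trans (cong weight (∂-b6 (suc m))) (weight-b3 (suc m)))
                (trans (cong ∂ (∂-b6 (suc m))) (∂-b3 m)))
  (cong (3 +_) (triWeight-b6 m))

triWeight-b3 : ∀ k → triWeight (b3 (k * 2)) ≡ secondWeight (k * 2)
triWeight-b3 zero = refl
triWeight-b3 (suc k) = trans
  (triWeight-∂∂ (b3 (2 + k * 2)) (weight-b3 (2 + k * 2)) (trans (cong weight (∂-b3 (suc (k * 2)))) (weight-b6 (suc (k * 2))))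
                (trans (cong ∂ (∂-b3 (suc (k * 2)))) (∂-b6 (k * 2))))
  (cong (3 +_) (triWeight-b3 k))

triWeight-alt-even : ∀ a k → triWeight (alt a (not a) (2 + k * 2)) ≡ secondWeight (k * 2)
triWeight-alt-even a k = begin
  triWeight (alt a (not a) (2 + k * 2))              ≡⟨ triWeight-alt a (suc (k * 2)) ⟩
  weight (alt a (not a) (suc k * 2)) + suc (k * 2)   ≡⟨ cong (_+ suc (k * 2)) (weight-alt-even a (suc k)) ⟩
  suc k + suc (k * 2)                                ≡⟨ secondWeight-even k ⟨
  secondWeight (k * 2)                               ∎
  where open ≡-Reasoning

triWeight-b4-odd : ∀ k → triWeight (b4 (suc (k * 2))) ≡ secondWeight (suc (k * 2))
triWeight-b4-odd k = begin
  triWeight (b4 (suc (k * 2)))                            ≡⟨ triWeight-alt false (suc (suc (k * 2))) ⟩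
  weight (alt true false (suc k * 2)) + suc (suc (k * 2)) ≡⟨ cong (_+ suc (suc (k * 2))) (weight-alt-even true (suc k)) ⟩
  suc k + suc (suc (k * 2))                               ≡⟨ secondWeight-odd k ⟨
  secondWeight (suc (k * 2))                              ∎
  where open ≡-Reasoning

triWeight-b1-odd : ∀ k → triWeight (b1 (suc (k * 2))) ≡ suc (secondWeight (suc (k * 2)))
triWeight-b1-odd k = begin
  triWeight (b1 (suc (k * 2)))                                  ≡⟨ triWeight-alt true (suc (suc (k * 2))) ⟩
  suc (weight (alt false true (suc k * 2))) + suc (suc (k * 2))
    ≡⟨ cong (λ w → suc w + suc (suc (k * 2))) (weight-alt-even false (suc k)) ⟩
  suc (suc k + suc (suc (k * 2)))                               ≡⟨ cong suc (secondWeight-odd k) ⟨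
  suc (secondWeight (suc (k * 2)))                              ∎
  where open ≡-Reasoning

W₂-even W₂-odd : ∀ m → List (Vec Bool (2 + m))
W₂-even m = b1 m ∷ b2 m ∷ b3 m ∷ b4 m ∷ b5 m ∷ b6 m ∷ []
W₂-odd m = b2 m ∷ b4 m ∷ b6 m ∷ []

Attains : ∀ m → List (Vec Bool (2 + m)) → Set
Attains m S = ∀ {s} → s ∈ S → triWeight s ≡ secondWeight m

W₂-even-attains : ∀ k → Attains (k * 2) (W₂-even (k * 2))
W₂-even-attains k (here refl) = triWeight-alt-even true k
W₂-even-attains k (there (here refl)) = triWeight-b2 (k * 2)
W₂-even-attains k (there (there (here refl))) = triWeight-b3 k
W₂-even-attains k (there (there (there (here refl)))) = triWeight-alt-even false k
W₂-even-attains k (there (there (there (there (here refl))))) = triWeight-b5 k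
W₂-even-attains k (there (there (there (there (there (here refl)))))) = triWeight-b6 (k * 2)

W₂-odd-attains : ∀ k → Attains (suc (k * 2)) (W₂-odd (suc (k * 2)))
W₂-odd-attains k (here refl) = triWeight-b2 (suc (k * 2))
W₂-odd-attains k (there (here refl)) = triWeight-b4-odd k
W₂-odd-attains k (there (there (here refl))) = triWeight-b6 (suc (k * 2))

3≰2 : ∀ {w} → ¬ 3 + w ≤ 2
3≰2 (s≤s (s≤s ()))

-- For m ≥ 6 the first letters of the integrals in the cases marked () already contain more
-- 1s than the stated weight, so Agda refutes them by evaluation.
integrate-W₂-even-weight≡1 : ∀ k {d} → d ∈ W₂-even (6 + k * 2) → ∀ a →
                             weight (integrate a d) ≡ 1 → integrate a d ∈ W₂-odd (7 + k * 2)
integrate-W₂-even-weight≡1 k (here refl) a eq = ⊥-elim (3≰2 (weight-integrate≡1⇒weight≤2 a _ eq))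
integrate-W₂-even-weight≡1 k (there (here refl)) false ()
integrate-W₂-even-weight≡1 k (there (here refl)) true ()
integrate-W₂-even-weight≡1 k (there (there (here refl))) false _ = there (there (here (integrate-b3 _)))
integrate-W₂-even-weight≡1 k (there (there (here refl))) true ()
integrate-W₂-even-weight≡1 k (there (there (there (here refl)))) a eq = ⊥-elim (3≰2 (weight-integrate≡1⇒weight≤2 a _ eq))
integrate-W₂-even-weight≡1 k (there (there (there (there (here refl))))) false _ = here (integrate-b5 _)
integrate-W₂-even-weight≡1 k (there (there (there (there (here refl))))) true ()
integrate-W₂-even-weight≡1 k (there (there (there (there (there (here refl)))))) false eq =
  ⊥-elim (≡b3⇒weight≢1 (integrate-b6 (6 + k * 2)) eq)
integrate-W₂-even-weight≡1 k (there (there (there (there (there (here refl)))))) true ()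

integrate-W₂-odd-weight≡2 : ∀ k {d} → d ∈ W₂-odd (7 + k * 2) → ∀ a →
                            weight (integrate a d) ≡ 2 → integrate a d ∈ W₂-even (8 + k * 2)
integrate-W₂-odd-weight≡2 k (here refl) false ()
integrate-W₂-odd-weight≡2 k (here refl) true _ = there (there (there (there (here (integrate-b2 _)))))
integrate-W₂-odd-weight≡2 k (there (here refl)) false ()
integrate-W₂-odd-weight≡2 k (there (here refl)) true ()
integrate-W₂-odd-weight≡2 k (there (there (here refl))) false _ = there (there (here (integrate-b6 _)))
integrate-W₂-odd-weight≡2 k (there (there (here refl))) true ()

integrate²-W₂-even-weight≡1 : ∀ k {y} → y ∈ W₂-even (6 + k * 2) → ∀ a c →
  weight (integrate a (integrate c y)) ≡ 1 → integrate a (integrate c y) ∈ W₂-even (8 + k * 2)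
integrate²-W₂-even-weight≡1 k (here refl) a false eq = ⊥-elim (3≰2 (weight-integrate≡1⇒weight≤2 a _ eq))
integrate²-W₂-even-weight≡1 k (here refl) a true eq = ⊥-elim (3≰2 (weight-integrate≡1⇒weight≤2 a _ eq))
integrate²-W₂-even-weight≡1 k (there (here refl)) false true _ =
  there (here (trans (cong (integrate false) (integrate-b2 _)) (integrate-b5 _)))
integrate²-W₂-even-weight≡1 k (there (here refl)) false false ()
integrate²-W₂-even-weight≡1 k (there (here refl)) true false ()
integrate²-W₂-even-weight≡1 k (there (here refl)) true true ()
integrate²-W₂-even-weight≡1 k (there (there (here refl))) false false eq =
  ⊥-elim (≡b3⇒weight≢1 (trans (cong (integrate false) (integrate-b3 (6 + k * 2))) (integrate-b6 (7 + k * 2))) eq)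
integrate²-W₂-even-weight≡1 k (there (there (here refl))) true false ()
integrate²-W₂-even-weight≡1 k (there (there (here refl))) false true ()
integrate²-W₂-even-weight≡1 k (there (there (here refl))) true true ()
integrate²-W₂-even-weight≡1 k (there (there (there (here refl)))) a false eq =
  ⊥-elim (3≰2 (weight-integrate≡1⇒weight≤2 a _ eq))
integrate²-W₂-even-weight≡1 k (there (there (there (here refl)))) a true eq =
  ⊥-elim (3≰2 (weight-integrate≡1⇒weight≤2 a _ eq))
integrate²-W₂-even-weight≡1 k (there (there (there (there (here refl))))) false false ()
integrate²-W₂-even-weight≡1 k (there (there (there (there (here refl))))) true false ()
integrate²-W₂-even-weight≡1 k (there (there (there (there (here refl))))) false true ()
integrate²-W₂-even-weight≡1 k (there (there (there (there (here refl))))) true true ()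
integrate²-W₂-even-weight≡1 k (there (there (there (there (there (here refl)))))) false false _ =
  there (there (there (there (there (here (trans (cong (integrate false) (integrate-b6 _)) (integrate-b3 _)))))))
integrate²-W₂-even-weight≡1 k (there (there (there (there (there (here refl)))))) true false ()
integrate²-W₂-even-weight≡1 k (there (there (there (there (there (here refl)))))) false true ()
integrate²-W₂-even-weight≡1 k (there (there (there (there (there (here refl)))))) true true ()

data Classified (m : ℕ) (S : List (Vec Bool (2 + m))) (x : Vec Bool (2 + m)) : Set where
  zeros-word     : x ≡ zeros (2 + m) → Classified m S x
  unitFirst-word : x ≡ unitFirst (suc m) → Classified m S x
  unitLast-word  : x ≡ unitLast (suc m) → Classified m S x
  ones-word      : x ≡ ones (2 + m) → Classified m S x
  member         : x ∈ S → Classified m S x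
  above          : secondWeight m < triWeight x → Classified m S x

Classification : ∀ m → List (Vec Bool (2 + m)) → Set
Classification m S = ∀ x → Classified m S x

triWeight-classified : ∀ {m S x} → Classified m S x →
                       triWeight x ≡ 0 ⊎ triWeight x ≡ 2 + m ⊎ x ∈ S ⊎ secondWeight m < triWeight x
triWeight-classified {m} (zeros-word refl) = inj₁ (triWeight-zeros (2 + m))
triWeight-classified {m} (unitFirst-word refl) = inj₂ (inj₁ (triWeight-unitFirst (suc m)))
triWeight-classified {m} (unitLast-word refl) = inj₂ (inj₁ (triWeight-unitLast (suc m)))
triWeight-classified {m} (ones-word refl) = inj₂ (inj₁ (triWeight-ones (2 + m)))
triWeight-classified (member x∈) = inj₂ (inj₂ (inj₁ x∈))
triWeight-classified (above lt) = inj₂ (inj₂ (inj₂ lt))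

above-by : ∀ {m S x t} → triWeight x ≡ t → secondWeight m < t → Classified m S x
above-by {m} eq lt = above (subst (secondWeight m <_) (sym eq) lt)

classified-integrate-zeros : ∀ {m S} a → Classified m S (integrate a (zeros (suc m)))
classified-integrate-zeros false = zeros-word (integrate-zeros false _)
classified-integrate-zeros true = ones-word (integrate-zeros true _)

classified-integrate-unitFirst : ∀ {m S} a → Classified (suc m) S (integrate a (unitFirst (suc m)))
classified-integrate-unitFirst {m} false = above-by (triWeight-integrate-unitFirst (suc m)) (secondWeight<double m)
classified-integrate-unitFirst true = unitFirst-word (integrate-unitFirst _)

classified-integrate-unitLast : ∀ {m S} a → Classified (suc m) S (integrate a (unitLast (suc m)))
classified-integrate-unitLast false = unitLast-word (integrate-unitLast _)
classified-integrate-unitLast {m} true = above-by (triWeight-integrate-unitLast (suc m)) (secondWeight<double m)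

classification-odd-step : ∀ k → Classification (6 + k * 2) (W₂-even _) → Classification (7 + k * 2) (W₂-odd _)
classification-odd-step k classify = integrate-elim (Classified _ _) (λ a d → lift a d (classify d))
  where
  m : ℕ
  m = 6 + k * 2
  sw-suc : secondWeight (suc m) ≡ suc (secondWeight m)
  sw-suc = secondWeight-suc-even (3 + k)
  lift : ∀ a d → Classified m (W₂-even m) d → Classified (suc m) (W₂-odd (suc m)) (integrate a d)
  lift a _ (zeros-word refl) = classified-integrate-zeros a
  lift a _ (unitFirst-word refl) = classified-integrate-unitFirst a
  lift a _ (unitLast-word refl) = classified-integrate-unitLast a
  lift false _ (ones-word refl) = member (there (here (integrate-ones false _)))
  lift true _ (ones-word refl) = above-by (trans (cong triWeight (integrate-ones true (2 + m))) (triWeight-b1-odd (3 + k))) ≤-refl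
  lift a d (member d∈) with weight (integrate a d) in eq
  ... | zero = ⊥-elim (<-irrefl (trans (sym (weight-integrate≡0 a d eq)) (W₂-even-attains (3 + k) d∈)) (0<secondWeight m))
  ... | suc zero = member (integrate-W₂-even-weight≡1 k d∈ a eq)
  ... | suc (suc w) = above (subst (_≤ triWeight (integrate a d)) (cong suc (sym sw-suc))
          (triWeight-integrate-≥ a d (subst (2 ≤_) (sym eq) (s≤s (s≤s z≤n)))
                                     (≤-reflexive (sym (W₂-even-attains (3 + k) d∈)))))
  lift a d (above lt) with weight (integrate a d) in eq
  ... | zero = ⊥-elim (n≮0 (subst (secondWeight m <_) (weight-integrate≡0 a d eq) lt))
  ... | suc w = above (subst (_≤ triWeight (integrate a d)) (cong suc (sym sw-suc))
          (triWeight-integrate-≥ a d (subst (1 ≤_) (sym eq) (s≤s z≤n)) lt))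

-- Here classifying ∂x alone only gives |T x| ≥ w₂, so the argument goes down to ∂²x:
-- |T x| = 1 + |∂x| + |T ∂²x|, and |∂x| ≥ 2 unless x is a unit word.
classified-weight≡1 : ∀ k → Classification (6 + k * 2) (W₂-even _) →
                      ∀ x → weight x ≡ 1 → Classified (8 + k * 2) (W₂-even _) x
classified-weight≡1 k classify = integrate-elim (λ x → weight x ≡ 1 → C x) λ a →
  integrate-elim (λ d → weight (integrate a d) ≡ 1 → C (integrate a d)) λ c y → lift a c y (classify y)
  where
  m : ℕ
  m = 6 + k * 2
  C : Vec Bool (4 + m) → Set
  C = Classified (2 + m) (W₂-even (2 + m))
  lift : ∀ a c y → Classified m (W₂-even m) y → weight (integrate a (integrate c y)) ≡ 1 → C (integrate a (integrate c y))
  lift false false _ (zeros-word refl) eq =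
    ⊥-elim (≡zeros⇒weight≢1 (trans (cong (integrate false) (integrate-zeros false (2 + m))) (integrate-zeros false (3 + m))) eq)
  lift false true _ (zeros-word refl) ()
  lift true false _ (zeros-word refl) ()
  lift true true _ (zeros-word refl) ()
  lift true true _ (unitFirst-word refl) _ =
    unitFirst-word (trans (cong (integrate true) (integrate-unitFirst (suc m))) (integrate-unitFirst (2 + m)))
  lift false false _ (unitFirst-word refl) ()
  lift false true _ (unitFirst-word refl) ()
  lift true false _ (unitFirst-word refl) ()
  lift false false _ (unitLast-word refl) _ =
    unitLast-word (trans (cong (integrate false) (integrate-unitLast (suc m))) (integrate-unitLast (2 + m)))
  lift false true _ (unitLast-word refl) ()
  lift true false _ (unitLast-word refl) ()
  lift true true _ (unitLast-word refl) ()
  lift false false _ (ones-word refl) ()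
  lift false true _ (ones-word refl) ()
  lift true false _ (ones-word refl) ()
  lift true true _ (ones-word refl) ()
  lift a c y (member y∈) eq = member (integrate²-W₂-even-weight≡1 k y∈ a c eq)
  lift a c y (above lt) eq with weight (integrate c y) in eq′
  ... | zero = ⊥-elim (n≮0 (subst (secondWeight m <_) (weight-integrate≡0 c y eq′) lt))
  ... | suc zero
    with weight-∂≡1⇒unit (integrate a (integrate c y)) eq (trans (cong weight (∂-integrate a (integrate c y))) eq′)
  ...   | inj₁ p = unitFirst-word p
  ...   | inj₂ p = unitLast-word p
  lift a c y (above lt) eq | suc (suc w) =
    above (triWeight-integrate-≥ a (integrate c y) (≤-reflexive (sym eq))
                                 (triWeight-integrate-≥ c y (subst (2 ≤_) (sym eq′) (s≤s (s≤s z≤n))) lt))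

classified-weight≢1 : ∀ k → Classification (7 + k * 2) (W₂-odd _) →
                      ∀ x → weight x ≢ 1 → Classified (8 + k * 2) (W₂-even _) x
classified-weight≢1 k classify = integrate-elim (λ x → weight x ≢ 1 → C x) λ a d → lift a d (classify d)
  where
  m : ℕ
  m = 6 + k * 2
  C : Vec Bool (4 + m) → Set
  C = Classified (2 + m) (W₂-even (2 + m))
  sw-suc : secondWeight (suc m) ≡ suc (secondWeight m)
  sw-suc = secondWeight-suc-even (3 + k)
  lift : ∀ a d → Classified (suc m) (W₂-odd (suc m)) d → weight (integrate a d) ≢ 1 → C (integrate a d)
  lift a _ (zeros-word refl) _ = classified-integrate-zeros a
  lift a _ (unitFirst-word refl) _ = classified-integrate-unitFirst a
  lift a _ (unitLast-word refl) _ = classified-integrate-unitLast a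
  lift false _ (ones-word refl) _ = member (there (there (there (here (integrate-ones false _)))))
  lift true _ (ones-word refl) _ = member (here (integrate-ones true _))
  lift a d (member d∈) w≢1 with weight (integrate a d) in eq
  ... | zero = ⊥-elim (<-irrefl (trans (sym (weight-integrate≡0 a d eq)) (W₂-odd-attains (3 + k) d∈)) (0<secondWeight (suc m)))
  ... | suc zero = ⊥-elim (w≢1 refl)
  ... | suc (suc zero) = member (integrate-W₂-odd-weight≡2 k d∈ a eq)
  ... | suc (suc (suc w)) = above (triWeight-integrate-≥ a d (subst (3 ≤_) (sym eq) (s≤s (s≤s (s≤s z≤n))))
                                                          (≤-reflexive (sym (trans (W₂-odd-attains (3 + k) d∈) sw-suc))))
  lift a d (above lt) w≢1 with weight (integrate a d) in eq
  ... | zero = ⊥-elim (n≮0 (subst (secondWeight (suc m) <_) (weight-integrate≡0 a d eq) lt))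
  ... | suc zero = ⊥-elim (w≢1 refl)
  ... | suc (suc w) = above (triWeight-integrate-≥ a d (subst (2 ≤_) (sym eq) (s≤s (s≤s z≤n)))
                                                    (subst (_< triWeight d) sw-suc lt))

classification-even-step : ∀ k → Classification (6 + k * 2) (W₂-even _) → Classification (7 + k * 2) (W₂-odd _) →
                           Classification (8 + k * 2) (W₂-even _)
classification-even-step k classify₀ classify₁ x with weight x ≟ 1
... | yes w≡1 = classified-weight≡1 k classify₀ x w≡1
... | no w≢1 = classified-weight≢1 k classify₁ x w≢1

words : ∀ n → List (Vec Bool n)
words zero = [] ∷ []
words (suc n) = map (true ∷_) (words n) ++ map (false ∷_) (words n)

∈-words : ∀ {n} (x : Vec Bool n) → x ∈ words n
∈-words [] = here refl
∈-words {suc n} (true ∷ x) = ∈-++⁺ˡ (∈-map⁺ (true ∷_) (∈-words x))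
∈-words {suc n} (false ∷ x) = ∈-++⁺ʳ (map (true ∷_) (words n)) (∈-map⁺ (false ∷_) (∈-words x))

_≟ᵥ_ : ∀ {n} → DecidableEquality (Vec Bool n)
_≟ᵥ_ = ≡-dec Bool._≟_

classified? : ∀ m S → Decidable (Classified m S)
classified? m S x
  with x ≟ᵥ zeros (2 + m) | x ≟ᵥ unitFirst (suc m) | x ≟ᵥ unitLast (suc m) | x ≟ᵥ ones (2 + m)
     | DecMembership._∈?_ _≟ᵥ_ x S | secondWeight m <? triWeight x
... | yes p | _ | _ | _ | _ | _ = yes (zeros-word p)
... | no _ | yes p | _ | _ | _ | _ = yes (unitFirst-word p)
... | no _ | no _ | yes p | _ | _ | _ = yes (unitLast-word p)
... | no _ | no _ | no _ | yes p | _ | _ = yes (ones-word p)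
... | no _ | no _ | no _ | no _ | yes p | _ = yes (member p)
... | no _ | no _ | no _ | no _ | no _ | yes p = yes (above p)
... | no ¬z | no ¬f | no ¬l | no ¬o | no ¬s | no ¬a = no λ where
  (zeros-word p) → ¬z p
  (unitFirst-word p) → ¬f p
  (unitLast-word p) → ¬l p
  (ones-word p) → ¬o p
  (member p) → ¬s p
  (above p) → ¬a p

classification-by-computation : ∀ m S → True (all? (classified? m S) (words (2 + m))) → Classification m S
classification-by-computation m S ok x = All.lookup (toWitness ok) (∈-words x)

attains-by-computation : ∀ m S → True (all? (λ s → triWeight s ≟ secondWeight m) S) → Attains m S
attains-by-computation m S ok = All.lookup (toWitness ok)

W₂-length6 : List (Vec Bool 6)
W₂-length6 = W₂-even 4 ++ (false ∷ false ∷ true ∷ false ∷ false ∷ false ∷ [])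
                        ∷ (false ∷ false ∷ false ∷ true ∷ false ∷ false ∷ [])
                        ∷ (false ∷ false ∷ true ∷ true ∷ false ∷ false ∷ []) ∷ []

W₂-length7 : List (Vec Bool 7)
W₂-length7 = W₂-odd 5 ++ (false ∷ false ∷ false ∷ true ∷ false ∷ false ∷ false ∷ []) ∷ []

classification₆ : Classification 4 W₂-length6
classification₆ = classification-by-computation 4 W₂-length6 _

classification₇ : Classification 5 W₂-length7
classification₇ = classification-by-computation 5 W₂-length7 _

-- The steps start at length 8 because W₂ has extra words at lengths 6 and 7.
classification-even : ∀ k → Classification (6 + k * 2) (W₂-even _)
classification-odd : ∀ k → Classification (7 + k * 2) (W₂-odd _)
classification-even zero = classification-by-computation 6 (W₂-even 6) _
classification-even (suc k) = classification-even-step k (classification-even k) (classification-odd k)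
classification-odd k = classification-odd-step k (classification-even k)

module _ {m S} (classify : Classification m S) (attains : Attains m S) (gap : 2 + m < secondWeight m) where

  attained-exactly-on : ∀ x → (triWeight x ≡ secondWeight m) ⇔ (x ∈ S)
  attained-exactly-on x = mk⇔ to attains
    where
    to : triWeight x ≡ secondWeight m → x ∈ S
    to eq with triWeight-classified (classify x)
    ... | inj₁ eq₀ = ⊥-elim (<-irrefl (trans (sym eq₀) eq) (<-trans (s≤s z≤n) gap))
    ... | inj₂ (inj₁ eqₙ) = ⊥-elim (<-irrefl (trans (sym eqₙ) eq) gap)
    ... | inj₂ (inj₂ (inj₁ x∈)) = x∈
    ... | inj₂ (inj₂ (inj₂ lt)) = ⊥-elim (<-irrefl (sym eq) lt)

  secondWeight-isNth : ∀ {s} → s ∈ S → IsNth (Achieved (2 + m)) 2 (secondWeight m)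
  secondWeight-isNth {s} s∈ =
    (s , attains s∈) , 2 + m , gap ,
    ((ones (2 + m) , triWeight-ones (2 + m)) , 0 , s≤s z≤n ,
     ((zeros (2 + m) , triWeight-zeros (2 + m)) , λ _ ()) , below-length) ,
    below-secondWeight
    where
    at-least-secondWeight : ∀ {x} → x ∈ S ⊎ secondWeight m < triWeight x → secondWeight m ≤ triWeight x
    at-least-secondWeight (inj₁ x∈) = ≤-reflexive (sym (attains x∈))
    at-least-secondWeight (inj₂ lt) = <⇒≤ lt
    below-length : ∀ t → 0 < t → t < 2 + m → ¬ Achieved (2 + m) t
    below-length t pos lt (x , refl) with triWeight-classified (classify x)
    ... | inj₁ eq = <-irrefl (sym eq) pos
    ... | inj₂ (inj₁ eq) = <-irrefl eq lt
    ... | inj₂ (inj₂ high) = <-irrefl refl (<-trans lt (<-≤-trans gap (at-least-secondWeight high)))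
    below-secondWeight : ∀ t → 2 + m < t → t < secondWeight m → ¬ Achieved (2 + m) t
    below-secondWeight t gt lt (x , refl) with triWeight-classified (classify x)
    ... | inj₁ eq = n≮0 (subst (2 + m <_) eq gt)
    ... | inj₂ (inj₁ eq) = <-irrefl (sym eq) gt
    ... | inj₂ (inj₂ high) = <-irrefl refl (<-≤-trans lt (at-least-secondWeight high))

even-or-odd : ∀ r → (∃[ k ] r ≡ k * 2) ⊎ (∃[ k ] r ≡ suc (k * 2))
even-or-odd zero = inj₁ (0 , refl)
even-or-odd (suc zero) = inj₂ (0 , refl)
even-or-odd (suc (suc r)) with even-or-odd r
... | inj₁ (k , refl) = inj₁ (suc k , refl)
... | inj₂ (k , refl) = inj₂ (suc k , refl)

secondWeight-isNth-from-6 : ∀ r → IsNth (Achieved (6 + r)) 2 (secondWeight (4 + r))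
secondWeight-isNth-from-6 0 =
  secondWeight-isNth classification₆ (attains-by-computation 4 W₂-length6 _) (length<secondWeight 2) (here refl)
secondWeight-isNth-from-6 1 =
  secondWeight-isNth classification₇ (attains-by-computation 5 W₂-length7 _) (length<secondWeight 3) (here refl)
secondWeight-isNth-from-6 (suc (suc r)) with even-or-odd r
... | inj₁ (k , refl) =
  secondWeight-isNth (classification-even k) (W₂-even-attains (3 + k)) (length<secondWeight (4 + k * 2)) (here refl)
... | inj₂ (k , refl) =
  secondWeight-isNth (classification-odd k) (W₂-odd-attains (3 + k)) (length<secondWeight (5 + k * 2)) (here refl)

W₂-even-exactly : ∀ m → 6 ≤ m → m % 2 ≡ 0 → ∀ x → (triWeight x ≡ secondWeight m) ⇔ (x ∈ W₂-even m)
W₂-even-exactly (suc (suc (suc (suc (suc (suc r)))))) (s≤s (s≤s (s≤s (s≤s (s≤s (s≤s _)))))) even with even-or-odd r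
... | inj₁ (k , refl) =
  attained-exactly-on (classification-even k) (W₂-even-attains (3 + k)) (length<secondWeight (4 + k * 2))
... | inj₂ (k , refl) = ⊥-elim (1+n≢0 (trans (sym ([m+kn]%n≡m%n 7 k 2)) even))

W₂-odd-exactly : ∀ m → 7 ≤ m → m % 2 ≡ 1 → ∀ x → (triWeight x ≡ secondWeight m) ⇔ (x ∈ W₂-odd m)
W₂-odd-exactly (suc (suc (suc (suc (suc (suc (suc r))))))) (s≤s (s≤s (s≤s (s≤s (s≤s (s≤s (s≤s _))))))) odd with even-or-odd r
... | inj₁ (k , refl) =
  attained-exactly-on (classification-odd k) (W₂-odd-attains (3 + k)) (length<secondWeight (5 + k * 2))
... | inj₂ (k , refl) = ⊥-elim (1+n≢0 (trans (sym odd) ([m+kn]%n≡m%n 8 k 2)))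

theorem5p6 : (∀ (n : ℕ) → 6 ≤ n → IsNth (Achieved n) 2 ((3 * n ∸ 2) / 2))
    × (∀ (x : Vec Bool 6) → (triWeight x ≡ (3 * 6 ∸ 2) / 2) ⇔ (x ∈ (b1 4 ∷ b2 4 ∷ b3 4 ∷ b4 4 ∷ b5 4 ∷ b6 4 ∷ (false ∷ false ∷ true ∷ false ∷ false ∷ false ∷ []) ∷ (false ∷ false ∷ false ∷ true ∷ false ∷ false ∷ []) ∷ (false ∷ false ∷ true ∷ true ∷ false ∷ false ∷ []) ∷ [])))
    × (∀ (x : Vec Bool 7) → (triWeight x ≡ (3 * 7 ∸ 2) / 2) ⇔ (x ∈ (b2 5 ∷ b4 5 ∷ b6 5 ∷ (false ∷ false ∷ false ∷ true ∷ false ∷ false ∷ false ∷ []) ∷ [])))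
    × (∀ (m : ℕ) → 6 ≤ m → m % 2 ≡ 0 → ∀ (x : Vec Bool (suc (suc m))) → (triWeight x ≡ (3 * suc (suc m) ∸ 2) / 2) ⇔ (x ∈ (b1 m ∷ b2 m ∷ b3 m ∷ b4 m ∷ b5 m ∷ b6 m ∷ [])))
    × (∀ (m : ℕ) → 7 ≤ m → m % 2 ≡ 1 → ∀ (x : Vec Bool (suc (suc m))) → (triWeight x ≡ (3 * suc (suc m) ∸ 2) / 2) ⇔ (x ∈ (b2 m ∷ b4 m ∷ b6 m ∷ [])))
theorem5p6 =
    (λ where (suc (suc (suc (suc (suc (suc r)))))) (s≤s (s≤s (s≤s (s≤s (s≤s (s≤s _)))))) →
               subst (IsNth (Achieved (6 + r)) 2) (secondWeight-formula (4 + r)) (secondWeight-isNth-from-6 r))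
  , by-formula {4} (attained-exactly-on classification₆ (attains-by-computation 4 W₂-length6 _) (length<secondWeight 2))
  , by-formula {5} (attained-exactly-on classification₇ (attains-by-computation 5 W₂-length7 _) (length<secondWeight 3))
  , (λ m 6≤m even → by-formula {m} (W₂-even-exactly m 6≤m even))
  , (λ m 7≤m odd → by-formula {m} (W₂-odd-exactly m 7≤m odd))
  where
  by-formula : ∀ {m S} → (∀ x → (triWeight x ≡ secondWeight m) ⇔ (x ∈ S)) →
               ∀ x → (triWeight x ≡ (3 * (2 + m) ∸ 2) / 2) ⇔ (x ∈ S)
  by-formula {m} {S} exactly x = subst (λ v → (triWeight x ≡ v) ⇔ (x ∈ S)) (secondWeight-formula m) (exactly x)
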